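{- Let $G$ be a finite permutation group containing a proper subgroup $H$ that is $2$-transitive (on the same set). Then $G$ is generated by $H\cup\mathrm{Der}_G$. In particular, if $H$ is generated by $\mathrm{Der}_H$, then $G$ is generated by $\mathrm{Der}_G$.
   Context: For a permutation group $L$, $\mathrm{Der}_L$ is the set of derangements (fixed-point-free elements) of $L$. -}

module Defs where

open import Data.Nat using (ℕ)
open import Data.Fin using (Fin)
open import Data.Fin.Permutation
  using (Permutation′; _⟨$⟩ʳ_; _≈_; id; flip; _∘ₚ_)
open import Data.Product using (Σ; ∃; _×_; _,_)
open import Data.Sum using (_⊎_)
open import Relation.Nullary using (¬_)
open import Relation.Binary.PropositionalEquality using (_≡_)

PermSet : ℕ → Set₁
PermSet n = Permutation′ n → Set

record IsPermGroup {n : ℕ} (G : PermSet n) : Set where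
  field
    resp-≈  : ∀ {σ τ} → σ ≈ τ → G σ → G τ
    has-id  : G id
    closed-∘ : ∀ {σ τ} → G σ → G τ → G (σ ∘ₚ τ)
    closed-⁻¹ : ∀ {σ} → G σ → G (flip σ)

_⊆_ : ∀ {n} → PermSet n → PermSet n → Set
H ⊆ G = ∀ σ → H σ → G σ

IsProperSubset : ∀ {n} → PermSet n → PermSet n → Set
IsProperSubset H G = (H ⊆ G) × (∃ λ σ → G σ × ¬ H σ)

Is2Transitive : ∀ {n} → PermSet n → Set
Is2Transitive {n} H =
  ∀ (a b c d : Fin n) → ¬ a ≡ b → ¬ c ≡ d →
    ∃ λ σ → H σ × (σ ⟨$⟩ʳ a ≡ c) × (σ ⟨$⟩ʳ b ≡ d)

Der : ∀ {n} → PermSet n → PermSet n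
Der L σ = L σ × (∀ i → ¬ σ ⟨$⟩ʳ i ≡ i)

_∪_ : ∀ {n} → PermSet n → PermSet n → PermSet n
(A ∪ B) σ = A σ ⊎ B σ

-- The subgroup generated by S (inductive closure; equality of permutations
-- is extensional, so the closure is closed under ≈).
data ⟨_⟩ {n : ℕ} (S : PermSet n) : PermSet n where
  gen  : ∀ {σ} → S σ → ⟨ S ⟩ σ
  gid  : ⟨ S ⟩ id
  gcomp : ∀ {σ τ} → ⟨ S ⟩ σ → ⟨ S ⟩ τ → ⟨ S ⟩ (σ ∘ₚ τ)
  ginv : ∀ {σ} → ⟨ S ⟩ σ → ⟨ S ⟩ (flip σ)
  gresp : ∀ {σ τ} → σ ≈ τ → ⟨ S ⟩ σ → ⟨ S ⟩ τ

GeneratedBy : ∀ {n} → PermSet n → PermSet n → Set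
GeneratedBy G S = (G ⊆ ⟨ S ⟩) × (⟨ S ⟩ ⊆ G)

module Submission where

-- Every g ∈ G is d ∘ h with h ∈ H and d = g h⁻¹ ∈ G, and d is a derangement
-- exactly when h disagrees with g at every point.  Such an h is found by an
-- averaging argument.  For a finite set K ⊆ H invariant under left
-- multiplication by a transitive family of permutations, the number of
-- members sending y to a does not depend on a, so a member of K agrees with g
-- at exactly one point on average.  Since some w₀ ∈ H agrees with g at two
-- points (2-transitivity), some member of K agrees with g nowhere.
--
-- As membership in H is not decidable, K is computed as the saturation of
-- {id} under finitely many elements of H (w₀ and one transporter a ↦ b per
-- pair of points), acting on the codes Fin (n ^ n) of the maps Fin n → Fin n.

open import Defs
open import Data.Bool.Base using (Bool; true; false; T)
open import Data.Bool.Properties using (T?)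
open import Data.Empty using (⊥-elim)
open import Data.Fin.Base using (Fin; zero; suc; finToFun; funToFin; combine)
open import Data.Fin.Permutation
  using (Permutation′; _⟨$⟩ʳ_; _⟨$⟩ˡ_; _≈_; id; flip; _∘ₚ_; permutation; inverseˡ; inverseʳ)
open import Data.Fin.Properties
  using (_≟_; any?; 0≢1+n; funToFin-finToFin; finToFun-funToFin)
open import Data.List.Base using (List; _∷_; allFin; cartesianProductWith)
open import Data.List.Membership.Propositional using (_∈_; find)
open import Data.List.Membership.Propositional.Properties
  using (∈-allFin; ∈-cartesianProductWith⁺; ∈-cartesianProductWith⁻)
open import Data.List.Relation.Unary.Any using (Any; here; there)
import Data.List.Relation.Unary.Any as Any
open import Data.Nat.Base using (ℕ; zero; suc; _+_; _*_; _^_; _≤_; _<_; z≤n; s≤s; NonZero)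
open import Data.Nat.Properties
  using ( +-mono-≤; +-mono-<-≤; +-mono-≤-<; +-monoˡ-≤; +-suc; +-identityʳ; *-identityʳ
        ; *-zeroʳ; *-cancelˡ-≡; m+n≡0⇒m≡0; m+n≡0⇒n≡0; m≤m+n; m≤n+m; ≤-refl; ≤-reflexive
        ; ≤-trans; <⇒≱; <-irrefl; n≢0⇒n>0; 1+n≢0; module ≤-Reasoning)
import Data.Nat.Properties as ℕ
open import Algebra.Properties.Semiring.Sum ℕ.+-*-semiring
  using (sum; sum-syntax; sum-cong-≗; ∑-comm; ∑-permute; *-distribˡ-sum)
open import Data.Product using (∃; _×_; _,_; proj₁; proj₂)
open import Data.Sum using (_⊎_; inj₁; inj₂)
open import Function.Base using (_∘_)
open import Relation.Binary.PropositionalEquality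
open import Relation.Nullary using (¬_; Dec; yes; no; ¬?; does)
open import Relation.Nullary.Decidable
  using (_×-dec_; _⊎-dec_; isYes; toWitness; fromWitness; decidable-stable)

⟨⟩-least : ∀ {n} {S G : PermSet n} → IsPermGroup G → S ⊆ G → ⟨ S ⟩ ⊆ G
⟨⟩-least G-group S⊆G σ (gen σ∈S)  = S⊆G σ σ∈S
⟨⟩-least G-group S⊆G _ gid         = IsPermGroup.has-id G-group
⟨⟩-least G-group S⊆G _ (gcomp p q) =
  IsPermGroup.closed-∘ G-group (⟨⟩-least G-group S⊆G _ p) (⟨⟩-least G-group S⊆G _ q)
⟨⟩-least G-group S⊆G _ (ginv p)    = IsPermGroup.closed-⁻¹ G-group (⟨⟩-least G-group S⊆G _ p)
⟨⟩-least G-group S⊆G _ (gresp e p) = IsPermGroup.resp-≈ G-group e (⟨⟩-least G-group S⊆G _ p)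

⟨⟩-isPermGroup : ∀ {n} {S : PermSet n} → IsPermGroup ⟨ S ⟩
⟨⟩-isPermGroup = record { resp-≈ = gresp ; has-id = gid ; closed-∘ = gcomp ; closed-⁻¹ = ginv }

⟨⟩-mono : ∀ {n} {S T : PermSet n} → S ⊆ T → ⟨ S ⟩ ⊆ ⟨ T ⟩
⟨⟩-mono S⊆T = ⟨⟩-least ⟨⟩-isPermGroup (λ σ → gen ∘ S⊆T σ)

sum-const : ∀ n c → ∑[ _ < n ] c ≡ n * c
sum-const zero    c = refl
sum-const (suc n) c = cong (c +_) (sum-const n c)

sum-mono : ∀ {n} {f g : Fin n → ℕ} → (∀ k → f k ≤ g k) → sum f ≤ sum g
sum-mono {zero}  _   = z≤n
sum-mono {suc n} f≤g = +-mono-≤ (f≤g zero) (sum-mono (f≤g ∘ suc))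

sum-mono-< : ∀ {n} {f g : Fin n → ℕ} (j : Fin n) →
  (∀ k → f k ≤ g k) → f j < g j → sum f < sum g
sum-mono-< {suc n} zero    f≤g fj<gj = +-mono-<-≤ fj<gj (sum-mono (f≤g ∘ suc))
sum-mono-< {suc n} (suc j) f≤g fj<gj = +-mono-≤-< (f≤g zero) (sum-mono-< j (f≤g ∘ suc) fj<gj)

sum≡0 : ∀ {n} (f : Fin n → ℕ) → sum f ≡ 0 → ∀ k → f k ≡ 0
sum≡0 {suc n} f Σf≡0 zero    = m+n≡0⇒m≡0 (f zero) Σf≡0
sum≡0 {suc n} f Σf≡0 (suc k) = sum≡0 (f ∘ suc) (m+n≡0⇒n≡0 (f zero) Σf≡0) k

two-terms≤sum : ∀ {m} (f : Fin (suc (suc m)) → ℕ) → 1 ≤ f zero → 1 ≤ f (suc zero) → 2 ≤ sum f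
two-terms≤sum f 1≤f₀ 1≤f₁ = +-mono-≤ 1≤f₀ (≤-trans 1≤f₁ (m≤m+n _ _))

⟦_⟧ : Bool → ℕ
⟦ true ⟧  = 1
⟦ false ⟧ = 0

δ : ∀ {n} → Fin n → Fin n → ℕ
δ x y = ⟦ does (x ≟ y) ⟧

δ-≡ : ∀ {n} {x y : Fin n} → x ≡ y → δ x y ≡ 1
δ-≡ {x = x} refl with x ≟ x
... | yes _  = refl
... | no x≢x = ⊥-elim (x≢x refl)

δ≡0⇒≢ : ∀ {n} {x y : Fin n} → δ x y ≡ 0 → x ≢ y
δ≡0⇒≢ δxy≡0 x≡y = 1+n≢0 (trans (sym (δ-≡ x≡y)) δxy≡0)

δ-sum : ∀ {n} (x : Fin n) → ∑[ y < n ] δ x y ≡ 1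
δ-sum {suc n} zero    = cong suc (trans (sum-const n 0) (*-zeroʳ n))
δ-sum {suc n} (suc x) = δ-sum x

BoolSet : ℕ → Set
BoolSet N = Fin N → Bool

_⊑_ : ∀ {N} → BoolSet N → BoolSet N → Set
S ⊑ S′ = ∀ k → T (S k) → T (S′ k)

T-ext : ∀ {a b} → (T a → T b) → (T b → T a) → a ≡ b
T-ext {false} {false} _   _   = refl
T-ext {false} {true}  _   b⇒a = ⊥-elim (b⇒a _)
T-ext {true}  {false} a⇒b _   = ⊥-elim (a⇒b _)
T-ext {true}  {true}  _   _   = refl

⟦⟧≤1 : ∀ b → ⟦ b ⟧ ≤ 1
⟦⟧≤1 true  = s≤s z≤n
⟦⟧≤1 false = z≤n

⟦⟧-mono : ∀ {a b} → (T a → T b) → ⟦ a ⟧ ≤ ⟦ b ⟧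
⟦⟧-mono {false}         _   = z≤n
⟦⟧-mono {true}  {true}  _   = ≤-refl
⟦⟧-mono {true}  {false} a⇒b = ⊥-elim (a⇒b _)

⟦⟧-< : ∀ {a b} → ¬ T a → T b → ⟦ a ⟧ < ⟦ b ⟧
⟦⟧-< {true}          ¬a _ = ⊥-elim (¬a _)
⟦⟧-< {false} {true}  _  _ = s≤s z≤n

∣_∣ : ∀ {N} → BoolSet N → ℕ
∣ S ∣ = sum (λ k → ⟦ S k ⟧)

∣∣≤ : ∀ {N} (S : BoolSet N) → ∣ S ∣ ≤ N
∣∣≤ {N} S = begin
  ∣ S ∣          ≤⟨ sum-mono (λ k → ⟦⟧≤1 (S k)) ⟩
  ∑[ _ < N ] 1   ≡⟨ sum-const N 1 ⟩
  N * 1          ≡⟨ *-identityʳ N ⟩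
  N              ∎
  where open ≤-Reasoning

∣∣-grows : ∀ {N} {S S′ : BoolSet N} (k : Fin N) →
  S ⊑ S′ → ¬ T (S k) → T (S′ k) → ∣ S ∣ < ∣ S′ ∣
∣∣-grows k S⊑S′ k∉S k∈S′ = sum-mono-< k (λ j → ⟦⟧-mono (S⊑S′ j)) (⟦⟧-< k∉S k∈S′)

below-average : ∀ {N} (K : BoolSet N) (f : Fin N → ℕ) →
  sum (λ k → ⟦ K k ⟧ * f k) ≡ ∣ K ∣ → ∀ j → T (K j) → 2 ≤ f j →
  ∃ λ k → T (K k) × f k ≡ 0
below-average K f total j j∈K 2≤fj with any? (λ k → T? (K k) ×-dec (f k ℕ.≟ 0))
... | yes vanishes = vanishes
... | no ¬vanishes =
  ⊥-elim (<-irrefl (sym total) (sum-mono-< j weight-≤ (weight-< (K j) j∈K)))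
  where
  -- Off K the weight vanishes; on K, f is at least 1 everywhere and 2 at j.
  weight-≤ : ∀ k → ⟦ K k ⟧ ≤ ⟦ K k ⟧ * f k
  weight-≤ k with K k in K≡
  ... | false = z≤n
  ... | true  = ≤-trans (n≢0⇒n>0 (λ fk≡0 → ¬vanishes (k , subst T (sym K≡) _ , fk≡0)))
                        (≤-reflexive (sym (+-identityʳ (f k))))
  weight-< : ∀ b → T b → ⟦ b ⟧ < ⟦ b ⟧ * f j
  weight-< true _ = ≤-trans 2≤fj (≤-reflexive (sym (+-identityʳ (f j))))

-- Iterating an extensive operator on the finitely many subsets of Fin N
-- reaches a subset that it does not enlarge.
module Saturation {N : ℕ} (step : BoolSet N → BoolSet N)
                  (extensive : ∀ S → S ⊑ step S) where

  stable-or-grows : ∀ S → step S ⊑ S ⊎ ∃ λ k → T (step S k) × ¬ T (S k)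
  stable-or-grows S with any? (λ k → T? (step S k) ×-dec ¬? (T? (S k)))
  ... | yes grows = inj₂ grows
  ... | no ¬grows = inj₁ λ k k∈step →
          decidable-stable (T? (S k)) (λ k∉S → ¬grows (k , k∈step , k∉S))

  Saturated : (P : BoolSet N → Set) → BoolSet N → Set
  Saturated P S = ∃ λ K → P K × S ⊑ K × step K ⊑ K

  -- Each strict growth uses up one unit of fuel.
  consume : ∀ {a b} fuel → N < a + suc fuel → a < b → N < b + fuel
  consume fuel room a<b =
    ≤-trans room (≤-trans (≤-reflexive (+-suc _ fuel)) (+-monoˡ-≤ fuel a<b))

  -- The invariant N < ∣ S ∣ + fuel bounds the number of remaining steps.
  saturate-within : (P : BoolSet N → Set) → (∀ {S} → P S → P (step S)) →
    ∀ fuel {S} → P S → N < ∣ S ∣ + fuel → Saturated P S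
  saturate-within P pres fuel {S} PS room with stable-or-grows S
  ... | inj₁ stable = S , PS , (λ _ k∈S → k∈S) , stable
  saturate-within P pres zero {S} PS room | inj₂ _ =
    ⊥-elim (<⇒≱ room (≤-trans (≤-reflexive (+-identityʳ ∣ S ∣)) (∣∣≤ S)))
  saturate-within P pres (suc fuel) {S} PS room | inj₂ (k , k∈step , k∉S)
    with K , PK , stepS⊑K , stable ← saturate-within P pres fuel (pres PS)
           (consume fuel room (∣∣-grows k (extensive S) k∉S k∈step))
    = K , PK , (λ j → stepS⊑K j ∘ extensive S j) , stable

  saturate : (P : BoolSet N → Set) → (∀ {S} → P S → P (step S)) →
    ∀ {S} → P S → Saturated P S
  saturate P pres {S} PS = saturate-within P pres (suc N) PS (m≤n+m (suc N) ∣ S ∣)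

⟨$⟩ʳ-injective : ∀ {n} (π : Permutation′ n) {x y} → π ⟨$⟩ʳ x ≡ π ⟨$⟩ʳ y → x ≡ y
⟨$⟩ʳ-injective π {x} {y} πx≡πy = begin
  x                   ≡⟨ inverseˡ π ⟨
  π ⟨$⟩ˡ (π ⟨$⟩ʳ x)   ≡⟨ cong (π ⟨$⟩ˡ_) πx≡πy ⟩
  π ⟨$⟩ˡ (π ⟨$⟩ʳ y)   ≡⟨ inverseˡ π ⟩
  y                   ∎
  where open ≡-Reasoning

δ-injective : ∀ {n} (π : Permutation′ n) x y → δ (π ⟨$⟩ʳ x) (π ⟨$⟩ʳ y) ≡ δ x y
δ-injective π x y with x ≟ y | π ⟨$⟩ʳ x ≟ π ⟨$⟩ʳ y
... | yes _   | yes _     = refl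
... | yes x≡y | no πx≢πy  = ⊥-elim (πx≢πy (cong (π ⟨$⟩ʳ_) x≡y))
... | no x≢y  | yes πx≡πy = ⊥-elim (x≢y (⟨$⟩ʳ-injective π πx≡πy))
... | no _    | no _      = refl

one-point : (σ : Permutation′ 1) → id ≈ σ
one-point σ zero with σ ⟨$⟩ʳ zero
... | zero = refl

transitive : ∀ {n} {H : PermSet n} → IsPermGroup H → Is2Transitive H →
  ∀ a b → ∃ λ π → H π × π ⟨$⟩ʳ a ≡ b
transitive H-group H-2trans a b with a ≟ b
... | yes refl = id , IsPermGroup.has-id H-group , refl
... | no a≢b with π , Hπ , πa≡b , _ ← H-2trans a b b a a≢b (a≢b ∘ sym) = π , Hπ , πa≡b

funToFin-cong : ∀ {m n} {f g : Fin m → Fin n} → (∀ i → f i ≡ g i) → funToFin f ≡ funToFin g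
funToFin-cong {zero}  _   = refl
funToFin-cong {suc m} f≗g = cong₂ combine (f≗g zero) (funToFin-cong (f≗g ∘ suc))

-- The maps Fin n → Fin n are coded by the elements of Fin (n ^ n), on which
-- permutations of Fin n act by post-composition.
module Coding (n : ℕ) where

  N : ℕ
  N = n ^ n

  Code : Set
  Code = Fin N

  decode : Code → Fin n → Fin n
  decode = finToFun

  encode : (Fin n → Fin n) → Code
  encode = funToFin

  encode-decode : ∀ k → encode (decode k) ≡ k
  encode-decode = funToFin-finToFin {n} {n}

  decode-encode : ∀ f i → decode (encode f) i ≡ f i
  decode-encode = finToFun-funToFin {n} {n}

  act : Permutation′ n → Code → Code
  act π k = encode (λ i → π ⟨$⟩ʳ decode k i)

  decode-act : ∀ π k i → decode (act π k) i ≡ π ⟨$⟩ʳ decode k i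
  decode-act π k = decode-encode _

  act-flip : ∀ π k → act (flip π) (act π k) ≡ k
  act-flip π k = begin
    act (flip π) (act π k)   ≡⟨ funToFin-cong (λ i → trans (cong (π ⟨$⟩ˡ_) (decode-act π k i)) (inverseˡ π)) ⟩
    encode (decode k)        ≡⟨ encode-decode k ⟩
    k                        ∎
    where open ≡-Reasoning

  flip-act : ∀ π k → act π (act (flip π) k) ≡ k
  flip-act π k = begin
    act π (act (flip π) k)   ≡⟨ funToFin-cong (λ i → trans (cong (π ⟨$⟩ʳ_) (decode-act (flip π) k i)) (inverseʳ π)) ⟩
    encode (decode k)        ≡⟨ encode-decode k ⟩
    k                        ∎
    where open ≡-Reasoning

  actₚ : Permutation′ n → Permutation′ N
  actₚ π = permutation (act π) (act (flip π)) (flip-act π) (act-flip π)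

  Invariant : BoolSet N → Permutation′ n → Set
  Invariant K π = ∀ k → K (act π k) ≡ K k

module Averaging (n : ℕ) ⦃ _ : NonZero n ⦄ (K : BoolSet (n ^ n)) where
  open Coding n

  Homogeneous : Set
  Homogeneous = ∀ a b → ∃ λ π → π ⟨$⟩ʳ a ≡ b × Invariant K π

  fibre : Fin n → Fin n → ℕ
  fibre y a = ∑[ k < N ] (⟦ K k ⟧ * δ (decode k y) a)

  fibre-invariant : ∀ {π} → Invariant K π → ∀ y a → fibre y (π ⟨$⟩ʳ a) ≡ fibre y a
  fibre-invariant {π} K-invariant y a = begin
    fibre y (π ⟨$⟩ʳ a)
      ≡⟨ ∑-permute (λ k → ⟦ K k ⟧ * δ (decode k y) (π ⟨$⟩ʳ a)) (actₚ π) ⟩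
    ∑[ k < N ] (⟦ K (act π k) ⟧ * δ (decode (act π k) y) (π ⟨$⟩ʳ a))
      ≡⟨ sum-cong-≗ (λ k → cong₂ _*_ (cong ⟦_⟧ (K-invariant k)) (moved k)) ⟩
    fibre y a ∎
    where
    open ≡-Reasoning
    moved : ∀ k → δ (decode (act π k) y) (π ⟨$⟩ʳ a) ≡ δ (decode k y) a
    moved k = trans (cong (λ z → δ z (π ⟨$⟩ʳ a)) (decode-act π k y)) (δ-injective π _ a)

  -- Every member of K lies in exactly one fibre over y.
  fibres-partition : ∀ y → ∑[ a < n ] fibre y a ≡ ∣ K ∣
  fibres-partition y = begin
    ∑[ a < n ] ∑[ k < N ] (⟦ K k ⟧ * δ (decode k y) a)
      ≡⟨ ∑-comm (λ a k → ⟦ K k ⟧ * δ (decode k y) a) ⟩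
    ∑[ k < N ] ∑[ a < n ] (⟦ K k ⟧ * δ (decode k y) a)
      ≡⟨ sum-cong-≗ (λ k → sym (*-distribˡ-sum ⟦ K k ⟧ (δ (decode k y)))) ⟩
    ∑[ k < N ] (⟦ K k ⟧ * ∑[ a < n ] δ (decode k y) a)
      ≡⟨ sum-cong-≗ (λ k → trans (cong (⟦ K k ⟧ *_) (δ-sum (decode k y))) (*-identityʳ ⟦ K k ⟧)) ⟩
    ∣ K ∣ ∎
    where open ≡-Reasoning

  fibre-constant : Homogeneous → ∀ y a → n * fibre y a ≡ ∣ K ∣
  fibre-constant homogeneous y a = begin
    n * fibre y a          ≡⟨ sum-const n (fibre y a) ⟨
    ∑[ b < n ] fibre y a   ≡⟨ sum-cong-≗ moved ⟩
    ∑[ b < n ] fibre y b   ≡⟨ fibres-partition y ⟩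
    ∣ K ∣                  ∎
    where
    open ≡-Reasoning
    moved : ∀ b → fibre y a ≡ fibre y b
    moved b with π , refl , K-invariant ← homogeneous a b =
      sym (fibre-invariant {π} K-invariant y a)

  agreement : (Fin n → Fin n) → Code → ℕ
  agreement g k = ∑[ i < n ] δ (decode k i) (g i)

  -- Counting agreements fibre by fibre: total agreement is n · ∣ K ∣ / n.
  average-agreement : Homogeneous → ∀ g → ∑[ k < N ] (⟦ K k ⟧ * agreement g k) ≡ ∣ K ∣
  average-agreement homogeneous g = *-cancelˡ-≡ _ _ n (begin
    n * ∑[ k < N ] (⟦ K k ⟧ * agreement g k)
      ≡⟨ cong (n *_) (sum-cong-≗ (λ k → *-distribˡ-sum ⟦ K k ⟧ (λ i → δ (decode k i) (g i)))) ⟩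
    n * ∑[ k < N ] ∑[ i < n ] (⟦ K k ⟧ * δ (decode k i) (g i))
      ≡⟨ cong (n *_) (∑-comm (λ k i → ⟦ K k ⟧ * δ (decode k i) (g i))) ⟩
    n * ∑[ i < n ] fibre i (g i)
      ≡⟨ *-distribˡ-sum n (λ i → fibre i (g i)) ⟩
    ∑[ i < n ] (n * fibre i (g i))
      ≡⟨ sum-cong-≗ (λ i → fibre-constant homogeneous i (g i)) ⟩
    ∑[ i < n ] ∣ K ∣
      ≡⟨ sum-const n ∣ K ∣ ⟩
    n * ∣ K ∣ ∎)
    where open ≡-Reasoning

-- For finitely many generators in a permutation group H: a decidable set of
-- codes of elements of H containing the identity and invariant under every
-- generator (the codes of the subgroup they generate, or a superset of it).
module Generated {n : ℕ} (H : PermSet n) (H-group : IsPermGroup H)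
                 (gens : List (Permutation′ n)) (gens⊆H : ∀ {π} → π ∈ gens → H π) where
  open Coding n
  open IsPermGroup H-group

  InH : Code → Set
  InH k = ∃ λ h → H h × (∀ i → h ⟨$⟩ʳ i ≡ decode k i)

  inH-unact : ∀ {π k} → H π → InH (act π k) → InH k
  inH-unact {π} {k} Hπ (h , Hh , h≗) =
    h ∘ₚ flip π , closed-∘ Hh (closed-⁻¹ Hπ) , λ i → begin
      π ⟨$⟩ˡ (h ⟨$⟩ʳ i)             ≡⟨ cong (π ⟨$⟩ˡ_) (h≗ i) ⟩
      π ⟨$⟩ˡ (decode (act π k) i)   ≡⟨ cong (π ⟨$⟩ˡ_) (decode-act π k i) ⟩
      π ⟨$⟩ˡ (π ⟨$⟩ʳ decode k i)    ≡⟨ inverseˡ π ⟩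
      decode k i                    ∎
    where open ≡-Reasoning

  Step : BoolSet N → Code → Set
  Step S k = T (S k) ⊎ Any (λ π → T (S (act (flip π) k)) ⊎ T (S (act π k))) gens

  Step? : ∀ S k → Dec (Step S k)
  Step? S k = T? (S k) ⊎-dec Any.any? (λ π → T? (S (act (flip π) k)) ⊎-dec T? (S (act π k))) gens

  step : BoolSet N → BoolSet N
  step S k = isYes (Step? S k)

  step-extensive : ∀ S → S ⊑ step S
  step-extensive S k k∈S = fromWitness (inj₁ k∈S)

  step-by : ∀ {S π k} → π ∈ gens → T (S (act (flip π) k)) ⊎ T (S (act π k)) → T (step S k)
  step-by π∈gens moved = fromWitness (inj₂ (Any.map (λ { refl → moved }) π∈gens))

  step-inH : ∀ {S} → (∀ k → T (S k) → InH k) → ∀ k → T (step S k) → InH k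
  step-inH {S} S⊆H k k∈step with toWitness k∈step
  ... | inj₁ k∈S = S⊆H k k∈S
  ... | inj₂ moved with find moved
  ... | π , π∈gens , inj₁ k∈πS   = inH-unact (closed-⁻¹ (gens⊆H π∈gens)) (S⊆H _ k∈πS)
  ... | π , π∈gens , inj₂ k∈π⁻¹S = inH-unact (gens⊆H π∈gens) (S⊆H _ k∈π⁻¹S)

  stable⇒invariant : ∀ {K} → step K ⊑ K → ∀ {π} → π ∈ gens → Invariant K π
  stable⇒invariant {K} stable {π} π∈gens k = T-ext forward backward
    where
    forward : T (K (act π k)) → T (K k)
    forward πk∈K = stable k (step-by {K} {π} {k} π∈gens (inj₂ πk∈K))
    backward : T (K k) → T (K (act π k))
    backward k∈K = stable (act π k)
      (step-by {K} {π} {act π k} π∈gens (inj₁ (subst (T ∘ K) (sym (act-flip π k)) k∈K)))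

  identity : Code
  identity = encode (λ i → i)

  singleton-identity : BoolSet N
  singleton-identity k = isYes (k ≟ identity)

  singleton-identity-inH : ∀ k → T (singleton-identity k) → InH k
  singleton-identity-inH k k∈S₀ with refl ← toWitness k∈S₀ =
    id , has-id , λ i → sym (decode-encode (λ i → i) i)

  open Saturation step step-extensive

  record Closure : Set where
    field
      K           : BoolSet N
      identity∈K  : T (K identity)
      K-invariant : ∀ {π} → π ∈ gens → Invariant K π
      K⊆H         : ∀ k → T (K k) → InH k

  closure : Closure
  closure with K , K⊆H , S₀⊑K , stable ← saturate (λ S → ∀ k → T (S k) → InH k) step-inH singleton-identity-inH
    = record { K = K ; identity∈K = S₀⊑K identity (fromWitness refl)
             ; K-invariant = stable⇒invariant stable ; K⊆H = K⊆H }

module Disagreement {m : ℕ} {H : PermSet (suc (suc m))} (H-group : IsPermGroup H)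
                    (H-2trans : Is2Transitive H) (g : Permutation′ (suc (suc m))) where
  n : ℕ
  n = suc (suc m)
  open Coding n

  transporter : Fin n → Fin n → Permutation′ n
  transporter a b = proj₁ (transitive H-group H-2trans a b)

  w₀-spec : ∃ λ w → H w × w ⟨$⟩ʳ zero ≡ g ⟨$⟩ʳ zero × w ⟨$⟩ʳ suc zero ≡ g ⟨$⟩ʳ suc zero
  w₀-spec = H-2trans zero (suc zero) _ _ (λ ()) (0≢1+n ∘ ⟨$⟩ʳ-injective g)

  w₀ : Permutation′ n
  w₀ = proj₁ w₀-spec

  gens : List (Permutation′ n)
  gens = w₀ ∷ cartesianProductWith transporter (allFin n) (allFin n)

  gens⊆H : ∀ {π} → π ∈ gens → H π
  gens⊆H (here refl) = proj₁ (proj₂ w₀-spec)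
  gens⊆H (there π∈transporters)
    with a , b , _ , _ , refl ← ∈-cartesianProductWith⁻ transporter (allFin n) (allFin n) π∈transporters
    = proj₁ (proj₂ (transitive H-group H-2trans a b))

  transporter∈gens : ∀ a b → transporter a b ∈ gens
  transporter∈gens a b = there (∈-cartesianProductWith⁺ transporter (∈-allFin a) (∈-allFin b))

  open Generated H H-group gens gens⊆H using (identity; Closure; closure)

  -- On the saturated set K a member agrees with g once on average, but the
  -- member w₀ agrees with g twice, so some member agrees with g nowhere.
  module InClosure (C : Closure) where
    open Closure C
    open Averaging n K

    homogeneous : Homogeneous
    homogeneous a b = transporter a b , proj₂ (proj₂ (transitive H-group H-2trans a b)) ,
                      K-invariant (transporter∈gens a b)

    w₀-code : Code
    w₀-code = act w₀ identity

    w₀∈K : T (K w₀-code)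
    w₀∈K = subst T (sym (K-invariant (here refl) identity)) identity∈K

    w₀-agrees-at : ∀ i → w₀ ⟨$⟩ʳ i ≡ g ⟨$⟩ʳ i → δ (decode w₀-code i) (g ⟨$⟩ʳ i) ≡ 1
    w₀-agrees-at i w₀i≡gi =
      δ-≡ (trans (decode-act w₀ identity i) (trans (cong (w₀ ⟨$⟩ʳ_) (decode-encode (λ j → j) i)) w₀i≡gi))

    w₀-agrees-twice : 2 ≤ agreement (g ⟨$⟩ʳ_) w₀-code
    w₀-agrees-twice = two-terms≤sum (λ i → δ (decode w₀-code i) (g ⟨$⟩ʳ i))
      (≤-reflexive (sym (w₀-agrees-at zero (proj₁ (proj₂ (proj₂ w₀-spec))))))
      (≤-reflexive (sym (w₀-agrees-at (suc zero) (proj₂ (proj₂ (proj₂ w₀-spec))))))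

    disagreeing : ∃ λ h → H h × (∀ i → h ⟨$⟩ʳ i ≢ g ⟨$⟩ʳ i)
    disagreeing
      with k , k∈K , never ← below-average K (agreement (g ⟨$⟩ʳ_))
                               (average-agreement homogeneous (g ⟨$⟩ʳ_)) w₀-code w₀∈K w₀-agrees-twice
      with h , Hh , h≗k ← K⊆H k k∈K
      = h , Hh , λ i hi≡gi →
          δ≡0⇒≢ (sum≡0 (λ j → δ (decode k j) (g ⟨$⟩ʳ j)) never i) (trans (sym (h≗k i)) hi≡gi)

  disagreeing : ∃ λ h → H h × (∀ i → h ⟨$⟩ʳ i ≢ g ⟨$⟩ʳ i)
  disagreeing = InClosure.disagreeing closure

factorisation : ∀ {n} {G H : PermSet n} → IsPermGroup G → H ⊆ G → ∀ {g} → G g →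
  (∃ λ h → H h × (∀ i → h ⟨$⟩ʳ i ≢ g ⟨$⟩ʳ i)) → ⟨ H ∪ Der G ⟩ g
factorisation {n} {G} G-group H⊆G {g} g∈G (h , h∈H , h≉g) =
  gresp (λ i → inverseʳ h) (gcomp (gen (inj₂ (d∈G , d-deranges))) (gen (inj₁ h∈H)))
  where
  d : Permutation′ n
  d = g ∘ₚ flip h
  d∈G : G d
  d∈G = IsPermGroup.closed-∘ G-group g∈G (IsPermGroup.closed-⁻¹ G-group (H⊆G h h∈H))
  d-deranges : ∀ i → d ⟨$⟩ʳ i ≢ i
  d-deranges i di≡i = h≉g i (sym (trans (sym (inverseʳ h)) (cong (h ⟨$⟩ʳ_) di≡i)))

-- On at least two points the factorisation exists by the disagreement lemma;
-- on at most one point g is the identity.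
G⊆⟨H∪DerG⟩ : ∀ n (G H : PermSet n) → IsPermGroup G → IsPermGroup H →
  H ⊆ G → Is2Transitive H → G ⊆ ⟨ H ∪ Der G ⟩
G⊆⟨H∪DerG⟩ zero G H G-group H-group H⊆G H-2trans g g∈G =
  gresp (λ ()) (gen (inj₁ (IsPermGroup.has-id H-group)))
G⊆⟨H∪DerG⟩ (suc zero) G H G-group H-group H⊆G H-2trans g g∈G =
  gresp (one-point g) (gen (inj₁ (IsPermGroup.has-id H-group)))
G⊆⟨H∪DerG⟩ (suc (suc m)) G H G-group H-group H⊆G H-2trans g g∈G =
  factorisation G-group H⊆G g∈G (Disagreement.disagreeing H-group H-2trans g)

G⊆⟨DerG⟩ : ∀ {n} {G H : PermSet n} → H ⊆ G → G ⊆ ⟨ H ∪ Der G ⟩ → H ⊆ ⟨ Der H ⟩ → G ⊆ ⟨ Der G ⟩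
G⊆⟨DerG⟩ {G = G} {H} H⊆G G⊆⟨H∪DerG⟩ H⊆⟨DerH⟩ g g∈G =
  ⟨⟩-least ⟨⟩-isPermGroup H∪DerG⊆⟨DerG⟩ g (G⊆⟨H∪DerG⟩ g g∈G)
  where
  H∪DerG⊆⟨DerG⟩ : (H ∪ Der G) ⊆ ⟨ Der G ⟩
  H∪DerG⊆⟨DerG⟩ σ (inj₁ σ∈H) =
    ⟨⟩-mono (λ τ (τ∈H , τ-deranges) → H⊆G τ τ∈H , τ-deranges) σ (H⊆⟨DerH⟩ σ σ∈H)
  H∪DerG⊆⟨DerG⟩ σ (inj₂ σ∈DerG) = gen σ∈DerG

-- The theorem.
lemma5p1 : (n : ℕ) (G H : PermSet n) →
    IsPermGroup G → IsPermGroup H →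
    IsProperSubset H G → Is2Transitive H →
    GeneratedBy G (H ∪ Der G)
      × (GeneratedBy H (Der H) → GeneratedBy G (Der G))
lemma5p1 n G H G-group H-group (H⊆G , _) H-2trans =
  (G⊆⟨S⟩ , ⟨⟩-least G-group S⊆G) ,
  λ (H⊆⟨DerH⟩ , _) → G⊆⟨DerG⟩ H⊆G G⊆⟨S⟩ H⊆⟨DerH⟩ , ⟨⟩-least G-group (λ _ → proj₁)
  where
  G⊆⟨S⟩ : G ⊆ ⟨ H ∪ Der G ⟩
  G⊆⟨S⟩ = G⊆⟨H∪DerG⟩ n G H G-group H-group H⊆G H-2trans
  S⊆G : (H ∪ Der G) ⊆ G
  S⊆G σ (inj₁ σ∈H)      = H⊆G σ σ∈H
  S⊆G σ (inj₂ (σ∈G , _)) = σ∈G
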